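{- Let $V$ be a vertex set with $|V|=n\ge 2$, and let $G$ be the disjoint union of $n-1$ spanning arborescences $A_1,\dots,A_{n-1}$ on $V$, where $A_{n-1}$ is a star rooted at $r$. For each $i\in[n-2]$ define an arc set $A'_i$ on $V-r$ as follows. (a) If the root of $A_i$ is $r$, choose any vertex $r'\in V-r$ with $(r,r')\in\delta^+_{A_i}(r)$ and set $A'_i := \{(r',v) \mid (r,v)\in\delta^+_{A_i}(r),\ v\neq r'\}\cup (A_i\setminus \delta^+_{A_i}(r))$. (b) Otherwise, let $r'$ be the parent of $r$ in $A_i$ and set $A'_i := \{(r',v)\mid (r,v)\in\delta^+_{A_i}(r)\}\cup (A_i\setminus(\delta^+_{A_i}(r)\cup\{(r',r)\}))$. Then each $A'_i$ is a spanning arborescence on $V-r$, and if $A_i$ is a star then $A'_i$ is a star. Moreover, if there exists a rainbow spanning arborescence on $V-r$ with respect to $(A'_1,\dots,A'_{n-2})$, then there exists a rainbow spanning arborescence on $V$ with respect to $(A_1,\dots,A_{n-1})$.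
   Context: An arborescence is a connected digraph in which exactly one vertex (the root) has no incoming arc and every other vertex has exactly one incoming arc; it is spanning on $V$ if its vertex set is $V$. For a non-root vertex, its parent is the tail of its unique incoming arc. A leaf is a vertex with no outgoing arc; a star is an arborescence in which every non-root vertex is a leaf. For a digraph $S$ and vertex $v$, $\delta^+_S(v)$ is the set of arcs of $S$ leaving $v$. Given arborescences $A_1,\dots,A_m$ (as disjoint arc sets, parallel arcs of different indices allowed), a subgraph $B$ of their union is rainbow with respect to $(A_1,\dots,A_m)$ if $|B\cap A_i|\le 1$ for all $i$. -}

module Defs where

open import Data.Nat using (ℕ; zero; suc; _≤_)
open import Data.Fin using (Fin; _≟_)
open import Data.Product using (Σ; _×_; _,_; proj₁; proj₂)
open import Data.List using (List; length; filter; map; _++_)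
open import Data.List.Membership.Propositional using (_∈_)
open import Data.List.Relation.Unary.Unique.Propositional using (Unique)
open import Data.Unit using (⊤)
open import Relation.Nullary using (¬_; yes; no)
open import Relation.Nullary.Decidable using (_×-dec_; ¬?)
open import Relation.Binary.PropositionalEquality using (_≡_; _≢_)
open import Data.Product.Properties using (≡-dec)

-- Arcs on the vertex set Fin n: (tail , head).
Arc : ℕ → Set
Arc n = Fin n × Fin n

Arcs : ℕ → Set
Arcs n = List (Arc n)

VSet : ℕ → Set₁
VSet n = Fin n → Set

full : ∀ {n} → VSet n
full _ = ⊤

minus : ∀ {n} → Fin n → VSet n
minus r v = v ≢ r

_≟ᵃ_ : ∀ {n} (a b : Arc n) → Relation.Nullary.Dec (a ≡ b)
_≟ᵃ_ = ≡-dec _≟_ _≟_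

indeg : ∀ {n} → Fin n → Arcs n → ℕ
indeg v A = length (filter (λ a → proj₂ a ≟ v) A)

outdeg : ∀ {n} → Fin n → Arcs n → ℕ
outdeg v A = length (filter (λ a → proj₁ a ≟ v) A)

data Walk {n} (A : Arcs n) : Fin n → Fin n → Set where
  here : ∀ {v} → Walk A v v
  fwd  : ∀ {u w v} → (u , w) ∈ A → Walk A w v → Walk A u v
  bwd  : ∀ {u w v} → (w , u) ∈ A → Walk A w v → Walk A u v

OnVertices : ∀ {n} → VSet n → Arcs n → Set
OnVertices S A = ∀ {a} → a ∈ A → S (proj₁ a) × S (proj₂ a)

Connected : ∀ {n} → VSet n → Arcs n → Set
Connected S A = ∀ u v → S u → S v → Walk A u v

IsArbRootedAt : ∀ {n} → VSet n → Fin n → Arcs n → Set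
IsArbRootedAt S ρ A =
  OnVertices S A × Connected S A × S ρ × indeg ρ A ≡ 0 ×
  (∀ v → S v → v ≢ ρ → indeg v A ≡ 1)

IsSpanningArb : ∀ {n} → VSet n → Arcs n → Set
IsSpanningArb S A = Σ _ λ ρ → IsArbRootedAt S ρ A

IsStarRootedAt : ∀ {n} → VSet n → Fin n → Arcs n → Set
IsStarRootedAt S ρ A = IsArbRootedAt S ρ A × (∀ v → S v → v ≢ ρ → outdeg v A ≡ 0)

IsStar : ∀ {n} → VSet n → Arcs n → Set
IsStar S A = Σ _ λ ρ → IsStarRootedAt S ρ A

IsParent : ∀ {n} → Arcs n → Fin n → Fin n → Set
IsParent A v p = (p , v) ∈ A

RootIs : ∀ {n} → Arcs n → Fin n → Set
RootIs A r = indeg r A ≡ 0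

ValidChoice : ∀ {n} → Fin n → Arcs n → Fin n → Set
ValidChoice r A r' =
  (RootIs A r → r' ≢ r × (r , r') ∈ A) × (¬ RootIs A r → IsParent A r r')

contract : ∀ {n} → Fin n → Fin n → Arcs n → Arcs n
contract r r' A with indeg r A Data.Nat.≟ 0
... | yes _ =
  map (λ a → (r' , proj₂ a)) (filter (λ a → (proj₁ a ≟ r) ×-dec ¬? (proj₂ a ≟ r')) A)
  ++ filter (λ a → ¬? (proj₁ a ≟ r)) A
... | no _ =
  map (λ a → (r' , proj₂ a)) (filter (λ a → proj₁ a ≟ r) A)
  ++ filter (λ a → ¬? (proj₁ a ≟ r) ×-dec ¬? (a ≟ᵃ (r' , r))) A

-- A rainbow subgraph of the union of A_1..A_m is a list of arcs labelled by the
-- index of the arborescence they come from, each label used at most once.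
RainbowArb : ∀ {n m} → VSet n → (Fin m → Arcs n) → Set
RainbowArb {n} {m} S A = Σ (List (Fin m × Arc n)) λ B →
  (∀ {i a} → (i , a) ∈ B → a ∈ A i) ×
  Unique (map proj₁ B) ×
  IsSpanningArb S (map proj₂ B)

{-# OPTIONS --safe #-}
-- Redirecting the arcs out of r to r' and deleting the arc between r and r' changes no head
-- except r and the new root, so every other vertex keeps exactly one incoming arc; a directed
-- path of Aᵢ from its root becomes a walk of A'ᵢ, since in case (a) the root r is replaced by r'
-- and in case (b) the detour r' → r → v is shortened to r' → v.
-- Conversely, a rainbow arborescence B' on V - r lifts to one on V rooted at r: an arc (x , y)
-- of colour i becomes (r , y) when that is an arc of Aᵢ (it is then the redirected copy of it)
-- and stays otherwise, and the arc of the star A_{n-1} from r to the root of B' is added in the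
-- unused colour. Heads do not change, so in-degrees stay right, and every vertex is reached
-- from r by following a path of B' back to its last rerouted arc.
module Submission where

open import Defs
open import Data.Nat as ℕ using (ℕ; suc; _+_; _<_)
open import Data.Nat.Properties using (+-suc; 0≢1+n; n≮0)
open import Data.Fin using (Fin; _≟_; fromℕ; inject₁)
open import Data.Fin.Properties using (fromℕ≢inject₁; inject₁-injective)
open import Data.Product using (∃-syntax; _×_; _,_; proj₁; proj₂)
open import Data.Sum using (_⊎_; inj₁; inj₂; [_,_])
open import Function using (_∘_)
open import Data.Empty using (⊥-elim)
open import Data.Unit using (tt)
open import Data.List using (List; []; _∷_; length; filter; map; _++_)
open import Data.List.Properties using (filter-accept; filter-reject; filter-++; length-++; map-id; map-∘)
open import Data.List.Membership.Propositional using (_∈_; _∉_)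
open import Data.List.Membership.Propositional.Properties
  using (∈-filter⁺; ∈-filter⁻; ∈-map⁺; ∈-map⁻; ∈-++⁺ˡ; ∈-++⁺ʳ; ∈-++⁻; ∈-length)
open import Data.List.Relation.Unary.Any using (here; there; any?)
open import Data.List.Relation.Unary.All as All using (All)
open import Data.List.Relation.Unary.AllPairs using (_∷_)
import Data.List.Relation.Unary.All.Properties as All
open import Data.List.Relation.Unary.Unique.Propositional using (Unique)
import Data.List.Relation.Unary.Unique.Propositional.Properties as Unique
open import Relation.Nullary using (¬_; Dec; yes; no; contradiction)
open import Relation.Nullary.Decidable using (_×-dec_; ¬?; decidable-stable)
open import Relation.Unary using (Decidable)
open import Relation.Binary.PropositionalEquality
  using (_≡_; _≢_; refl; sym; trans; cong; cong₂; subst; module ≡-Reasoning)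

length≡1⇒∈-unique : ∀ {X : Set} {xs : List X} {x y} → length xs ≡ 1 → x ∈ xs → y ∈ xs → x ≡ y
length≡1⇒∈-unique {xs = _ ∷ []} _ (here refl) (here refl) = refl
length≡1⇒∈-unique {xs = _ ∷ []} _ (there ()) _
length≡1⇒∈-unique {xs = _ ∷ []} _ _ (there ())

-- indeg v and outdeg v unfold to degree proj₂ v and degree proj₁ v.
degree : ∀ {n} → (Arc n → Fin n) → Fin n → Arcs n → ℕ
degree end v as = length (filter (λ a → end a ≟ v) as)

module _ {n} (end : Arc n → Fin n) {v : Fin n} where
  private
    ends-at? : Decidable (λ a → end a ≡ v)
    ends-at? a = end a ≟ v

  degree-∷-≡ : ∀ {a as} → end a ≡ v → degree end v (a ∷ as) ≡ suc (degree end v as)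
  degree-∷-≡ e = cong length (filter-accept ends-at? e)

  degree-∷-≢ : ∀ {a as} → end a ≢ v → degree end v (a ∷ as) ≡ degree end v as
  degree-∷-≢ e = cong length (filter-reject ends-at? e)

  degree≡0⇒≢ : ∀ {as a} → degree end v as ≡ 0 → a ∈ as → end a ≢ v
  degree≡0⇒≢ d m e = n≮0 (subst (0 <_) d (∈-length (∈-filter⁺ ends-at? m e)))

  ≢⇒degree≡0 : ∀ as → (∀ {a} → a ∈ as → end a ≢ v) → degree end v as ≡ 0
  ≢⇒degree≡0 [] _ = refl
  ≢⇒degree≡0 (a ∷ as) ≢v =
    trans (degree-∷-≢ (≢v (here refl))) (≢⇒degree≡0 as (λ m → ≢v (there m)))

  degree≡1⇒unique : ∀ {as a b} → degree end v as ≡ 1 →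
                    a ∈ as → b ∈ as → end a ≡ v → end b ≡ v → a ≡ b
  degree≡1⇒unique d ma mb ea eb =
    length≡1⇒∈-unique d (∈-filter⁺ ends-at? ma ea) (∈-filter⁺ ends-at? mb eb)

  degree≡1⇒∃ : ∀ as → degree end v as ≡ 1 → ∃[ a ] a ∈ as × end a ≡ v
  degree≡1⇒∃ as d with filter ends-at? as in eq
  ... | a ∷ _ = a , ∈-filter⁻ ends-at? (subst (a ∈_) (sym eq) (here refl))

  degree-++ : ∀ as bs → degree end v (as ++ bs) ≡ degree end v as + degree end v bs
  degree-++ as bs = trans (cong length (filter-++ ends-at? as bs)) (length-++ (filter ends-at? as))

  degree-∷-cong : ∀ {a b as bs} → end a ≡ end b → degree end v as ≡ degree end v bs →
                  degree end v (a ∷ as) ≡ degree end v (b ∷ bs)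
  degree-∷-cong {a} ea≡eb d with end a ≟ v
  ... | yes ea≡v = trans (cong suc d) (sym (degree-∷-≡ (trans (sym ea≡eb) ea≡v)))
  ... | no ea≢v = trans d (sym (degree-∷-≢ (λ eb≡v → ea≢v (trans ea≡eb eb≡v))))

  degree-map-cong : ∀ {X : Set} (f g : X → Arc n) → (∀ x → end (f x) ≡ end (g x)) →
                    ∀ xs → degree end v (map f xs) ≡ degree end v (map g xs)
  degree-map-cong f g same [] = refl
  degree-map-cong f g same (x ∷ xs) = degree-∷-cong (same x) (degree-map-cong f g same xs)

  degree-filter-∷-≢ : ∀ {R : Arc n → Set} (R? : Decidable R) {a} as → end a ≢ v →
                      degree end v (filter R? (a ∷ as)) ≡ degree end v (filter R? as)
  degree-filter-∷-≢ R? {a} as ea≢v with R? a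
  ... | yes _ = degree-∷-≢ ea≢v
  ... | no _ = refl

  degree-filter-∷-accept : ∀ {R : Arc n → Set} (R? : Decidable R) {a} as → R a → end a ≡ v →
                           degree end v (filter R? (a ∷ as)) ≡ suc (degree end v (filter R? as))
  degree-filter-∷-accept R? as r ea≡v = trans (cong (degree end v) (filter-accept R? r)) (degree-∷-≡ ea≡v)

  degree-filter-∷-reject : ∀ {R : Arc n → Set} (R? : Decidable R) {a} as → ¬ R a →
                           degree end v (filter R? (a ∷ as)) ≡ degree end v (filter R? as)
  degree-filter-∷-reject R? as ¬r = cong (degree end v) (filter-reject R? ¬r)

  module _ {P Q : Arc n → Set} (P? : Decidable P) (Q? : Decidable Q) where
    degree-partition : ∀ as → (∀ {a} → a ∈ as → end a ≡ v → (P a × ¬ Q a) ⊎ (¬ P a × Q a)) →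
                       degree end v (filter P? as) + degree end v (filter Q? as) ≡ degree end v as
    degree-partition [] _ = refl
    degree-partition (a ∷ as) split = go (end a ≟ v)
      where
      open ≡-Reasoning
      ih : degree end v (filter P? as) + degree end v (filter Q? as) ≡ degree end v as
      ih = degree-partition as (λ m → split (there m))
      go : Dec (end a ≡ v) →
           degree end v (filter P? (a ∷ as)) + degree end v (filter Q? (a ∷ as)) ≡ degree end v (a ∷ as)
      go (no ea≢v) = begin
        degree end v (filter P? (a ∷ as)) + degree end v (filter Q? (a ∷ as))
          ≡⟨ cong₂ _+_ (degree-filter-∷-≢ P? as ea≢v) (degree-filter-∷-≢ Q? as ea≢v) ⟩
        degree end v (filter P? as) + degree end v (filter Q? as)
          ≡⟨ ih ⟩
        degree end v as
          ≡⟨ degree-∷-≢ ea≢v ⟨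
        degree end v (a ∷ as) ∎
      go (yes ea≡v) with split (here refl) ea≡v
      ... | inj₁ (p , ¬q) = begin
        degree end v (filter P? (a ∷ as)) + degree end v (filter Q? (a ∷ as))
          ≡⟨ cong₂ _+_ (degree-filter-∷-accept P? as p ea≡v) (degree-filter-∷-reject Q? as ¬q) ⟩
        suc (degree end v (filter P? as) + degree end v (filter Q? as))
          ≡⟨ cong suc ih ⟩
        suc (degree end v as)
          ≡⟨ degree-∷-≡ ea≡v ⟨
        degree end v (a ∷ as) ∎
      ... | inj₂ (¬p , q) = begin
        degree end v (filter P? (a ∷ as)) + degree end v (filter Q? (a ∷ as))
          ≡⟨ cong₂ _+_ (degree-filter-∷-reject P? as ¬p) (degree-filter-∷-accept Q? as q ea≡v) ⟩
        degree end v (filter P? as) + suc (degree end v (filter Q? as))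
          ≡⟨ +-suc _ _ ⟩
        suc (degree end v (filter P? as) + degree end v (filter Q? as))
          ≡⟨ cong suc ih ⟩
        suc (degree end v as)
          ≡⟨ degree-∷-≡ ea≡v ⟨
        degree end v (a ∷ as) ∎

module _ {n} {A : Arcs n} where
  walk-++ : ∀ {u w v} → Walk A u w → Walk A w v → Walk A u v
  walk-++ here q = q
  walk-++ (fwd e p) q = fwd e (walk-++ p q)
  walk-++ (bwd e p) q = bwd e (walk-++ p q)

  walk-snoc : ∀ {u x v} → Walk A u x → (x , v) ∈ A → Walk A u v
  walk-snoc p e = walk-++ p (fwd e here)

  walk-reverse : ∀ {u v} → Walk A u v → Walk A v u
  walk-reverse here = here
  walk-reverse (fwd e p) = walk-++ (walk-reverse p) (bwd e here)
  walk-reverse (bwd e p) = walk-++ (walk-reverse p) (fwd e here)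

  walks-from⇒connected : ∀ {S : VSet n} {ρ} → (∀ v → S v → Walk A ρ v) → Connected S A
  walks-from⇒connected walk u v u∈S v∈S = walk-++ (walk-reverse (walk u u∈S)) (walk v v∈S)

infixl 5 _▸_

data Path {n} (A : Arcs n) (u : Fin n) : Fin n → Set where
  start : Path A u u
  _▸_ : ∀ {x v} → Path A u x → (x , v) ∈ A → Path A u v

module Arborescence {n} {S : VSet n} {ρ : Fin n} {A : Arcs n} (isArb : IsArbRootedAt S ρ A) where
  on-vertices : OnVertices S A
  on-vertices = proj₁ isArb

  connected : Connected S A
  connected = proj₁ (proj₂ isArb)

  root∈S : S ρ
  root∈S = proj₁ (proj₂ (proj₂ isArb))

  indeg-root : indeg ρ A ≡ 0
  indeg-root = proj₁ (proj₂ (proj₂ (proj₂ isArb)))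

  indeg-nonroot : ∀ v → S v → v ≢ ρ → indeg v A ≡ 1
  indeg-nonroot = proj₂ (proj₂ (proj₂ (proj₂ isArb)))

  head≢root : ∀ {a} → a ∈ A → proj₂ a ≢ ρ
  head≢root = degree≡0⇒≢ proj₂ indeg-root

  parent-unique : ∀ {x y v} → (x , v) ∈ A → (y , v) ∈ A → x ≡ y
  parent-unique {v = v} xv yv = cong proj₁
    (degree≡1⇒unique proj₂ (indeg-nonroot v (proj₂ (on-vertices xv)) (head≢root xv)) xv yv refl refl)

  indeg≡0⇒root : ∀ {v} → S v → indeg v A ≡ 0 → v ≡ ρ
  indeg≡0⇒root {v} v∈S d =
    decidable-stable (v ≟ ρ) λ v≢ρ → 0≢1+n (trans (sym d) (indeg-nonroot v v∈S v≢ρ))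

  -- A path from the root cannot end at the root, and its last arc is the unique arc into its endpoint.
  path-back : ∀ {w u} → (w , u) ∈ A → Path A ρ u → Path A ρ w
  path-back wu start = ⊥-elim (head≢root wu refl)
  path-back wu (p ▸ xu) = subst (Path A ρ) (parent-unique xu wu) p

  walk⇒path : ∀ {u v} → Walk A u v → Path A ρ u → Path A ρ v
  walk⇒path here p = p
  walk⇒path (fwd e w) p = walk⇒path w (p ▸ e)
  walk⇒path (bwd e w) p = walk⇒path w (path-back e p)

  path-from-root : ∀ v → S v → Path A ρ v
  path-from-root v v∈S = walk⇒path (connected ρ v root∈S v∈S) start

  no-loop : ∀ {v} → (v , v) ∉ A
  no-loop {v} vv = ends-before (path-from-root v (proj₁ (on-vertices vv))) refl
    where
    ends-before : ∀ {u} → Path A ρ u → u ≢ v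
    ends-before start refl = head≢root vv refl
    ends-before (p ▸ xu) refl = ends-before p (parent-unique xu vv)

NonRootsAreLeaves : ∀ {n} → VSet n → Fin n → Arcs n → Set
NonRootsAreLeaves S ρ A = ∀ v → S v → v ≢ ρ → outdeg v A ≡ 0

star-arc : ∀ {n} {ρ : Fin n} {A} → IsStarRootedAt full ρ A → ∀ {v} → v ≢ ρ → (ρ , v) ∈ A
star-arc {ρ = ρ} {A} (isArb , leaves) {v} v≢ρ
  with (x , _) , xv , refl ← degree≡1⇒∃ proj₂ A (Arborescence.indeg-nonroot isArb v tt v≢ρ)
  = subst (λ t → (t , v) ∈ A) tail≡ρ xv
  where
  tail≡ρ : x ≡ ρ
  tail≡ρ = decidable-stable (x ≟ ρ) λ x≢ρ → degree≡0⇒≢ proj₁ (leaves x tt x≢ρ) xv refl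

redirect : ∀ {n} → Fin n → Arc n → Arc n
redirect r' a = (r' , proj₂ a)

indeg-redirect-++ : ∀ {n} (v r' : Fin n) (as bs : Arcs n) →
                    indeg v (map (redirect r') as ++ bs) ≡ indeg v as + indeg v bs
indeg-redirect-++ v r' as bs = trans (degree-++ proj₂ (map (redirect r') as) bs)
  (cong (_+ indeg v bs) (trans (degree-map-cong proj₂ (redirect r') (λ a → a) (λ _ → refl) as)
                               (cong (indeg v) (map-id as))))

module ContractAtRoot {n} (r r' : Fin n) (A : Arcs n) where
  Moved Kept : Arc n → Set
  Moved a = proj₁ a ≡ r × proj₂ a ≢ r'
  Kept a = proj₁ a ≢ r

  moved? : Decidable Moved
  moved? a = (proj₁ a ≟ r) ×-dec ¬? (proj₂ a ≟ r')

  kept? : Decidable Kept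
  kept? a = ¬? (proj₁ a ≟ r)

  -- Definitionally the case-(a) branch of contract.
  contracted : Arcs n
  contracted = map (redirect r') (filter moved? A) ++ filter kept? A

  ∈-contracted⁺-moved : ∀ {y} → (r , y) ∈ A → y ≢ r' → (r' , y) ∈ contracted
  ∈-contracted⁺-moved ry y≢r' = ∈-++⁺ˡ (∈-map⁺ (redirect r') (∈-filter⁺ moved? ry (refl , y≢r')))

  ∈-contracted⁺-kept : ∀ {x y} → (x , y) ∈ A → x ≢ r → (x , y) ∈ contracted
  ∈-contracted⁺-kept xy x≢r = ∈-++⁺ʳ _ (∈-filter⁺ kept? xy x≢r)

  ∈-contracted⁻ : ∀ {a} → a ∈ contracted →
                  (proj₁ a ≡ r' × (r , proj₂ a) ∈ A × proj₂ a ≢ r') ⊎ (a ∈ A × Kept a)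
  ∈-contracted⁻ m with ∈-++⁻ (map (redirect r') (filter moved? A)) m
  ... | inj₂ m-kept = inj₂ (∈-filter⁻ kept? m-kept)
  ... | inj₁ m-moved with ∈-map⁻ (redirect r') m-moved
  ...   | _ , m-A , refl with ∈-filter⁻ moved? m-A
  ...     | ry , (refl , y≢r') = inj₁ (refl , ry , y≢r')

  module _ (isArb : IsArbRootedAt full r A) (r'≢r : r' ≢ r) (rr' : (r , r') ∈ A) where
    open Arborescence isArb

    contracted-on-vertices : OnVertices (minus r) contracted
    contracted-on-vertices m with ∈-contracted⁻ m
    ... | inj₁ (refl , ry , _) = r'≢r , head≢root ry
    ... | inj₂ (xy , x≢r) = x≢r , head≢root xy

    walk-from-r' : ∀ {v} → Path A r v → v ≢ r → Walk contracted r' v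
    walk-from-r' start v≢r = contradiction refl v≢r
    walk-from-r' (_▸_ {x} {v} p xv) v≢r with x ≟ r | v ≟ r'
    ... | no x≢r | _ = walk-snoc (walk-from-r' p x≢r) (∈-contracted⁺-kept xv x≢r)
    ... | yes refl | yes refl = here
    ... | yes refl | no v≢r' = fwd (∈-contracted⁺-moved xv v≢r') here

    contracted-indeg-root : indeg r' contracted ≡ 0
    contracted-indeg-root = ≢⇒degree≡0 proj₂ contracted head≢r'
      where
      head≢r' : ∀ {a} → a ∈ contracted → proj₂ a ≢ r'
      head≢r' m with ∈-contracted⁻ m
      ... | inj₁ (_ , _ , y≢r') = y≢r'
      ... | inj₂ (xy , x≢r) = λ { refl → x≢r (parent-unique xy rr') }

    contracted-indeg-nonroot : ∀ v → v ≢ r → v ≢ r' → indeg v contracted ≡ 1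
    contracted-indeg-nonroot v v≢r v≢r' = trans (indeg-redirect-++ v r' (filter moved? A) (filter kept? A))
      (trans (degree-partition proj₂ moved? kept? A exactly-one) (indeg-nonroot v tt v≢r))
      where
      exactly-one : ∀ {a} → a ∈ A → proj₂ a ≡ v → (Moved a × ¬ Kept a) ⊎ (¬ Moved a × Kept a)
      exactly-one {x , _} _ refl with x ≟ r
      ... | yes x≡r = inj₁ ((x≡r , v≢r') , λ x≢r → x≢r x≡r)
      ... | no x≢r = inj₂ ((λ moved → x≢r (proj₁ moved)) , x≢r)

    contracted-isArb : IsArbRootedAt (minus r) r' contracted
    contracted-isArb = contracted-on-vertices
      , walks-from⇒connected (λ v v≢r → walk-from-r' (path-from-root v tt) v≢r)
      , r'≢r , contracted-indeg-root , contracted-indeg-nonroot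

    contracted-leaves : NonRootsAreLeaves full r A → NonRootsAreLeaves (minus r) r' contracted
    contracted-leaves leaves v v≢r v≢r' = ≢⇒degree≡0 proj₁ contracted tail≢v
      where
      tail≢v : ∀ {a} → a ∈ contracted → proj₁ a ≢ v
      tail≢v m with ∈-contracted⁻ m
      ... | inj₁ (refl , _) = λ r'≡v → v≢r' (sym r'≡v)
      ... | inj₂ (a∈A , _) = degree≡0⇒≢ proj₁ (leaves v tt v≢r) a∈A

module ContractAtNonRoot {n} (r r' : Fin n) (A : Arcs n) where
  Moved Kept : Arc n → Set
  Moved a = proj₁ a ≡ r
  Kept a = proj₁ a ≢ r × a ≢ (r' , r)

  moved? : Decidable Moved
  moved? a = proj₁ a ≟ r

  kept? : Decidable Kept
  kept? a = ¬? (proj₁ a ≟ r) ×-dec ¬? (a ≟ᵃ (r' , r))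

  -- Definitionally the case-(b) branch of contract.
  contracted : Arcs n
  contracted = map (redirect r') (filter moved? A) ++ filter kept? A

  ∈-contracted⁺-moved : ∀ {y} → (r , y) ∈ A → (r' , y) ∈ contracted
  ∈-contracted⁺-moved ry = ∈-++⁺ˡ (∈-map⁺ (redirect r') (∈-filter⁺ moved? ry refl))

  ∈-contracted⁺-kept : ∀ {x y} → (x , y) ∈ A → x ≢ r → y ≢ r → (x , y) ∈ contracted
  ∈-contracted⁺-kept xy x≢r y≢r = ∈-++⁺ʳ _ (∈-filter⁺ kept? xy (x≢r , λ { refl → y≢r refl }))

  ∈-contracted⁻ : ∀ {a} → a ∈ contracted →
                  (proj₁ a ≡ r' × (r , proj₂ a) ∈ A) ⊎ (a ∈ A × Kept a)
  ∈-contracted⁻ m with ∈-++⁻ (map (redirect r') (filter moved? A)) m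
  ... | inj₂ m-kept = inj₂ (∈-filter⁻ kept? m-kept)
  ... | inj₁ m-moved with ∈-map⁻ (redirect r') m-moved
  ...   | _ , m-A , refl with ∈-filter⁻ moved? m-A
  ...     | ry , refl = inj₁ (refl , ry)

  module _ {ρ} (isArb : IsArbRootedAt full ρ A) (ρ≢r : ρ ≢ r) (r'r : (r' , r) ∈ A) where
    open Arborescence isArb

    r'≢r : r' ≢ r
    r'≢r refl = no-loop r'r

    contracted-on-vertices : OnVertices (minus r) contracted
    contracted-on-vertices m with ∈-contracted⁻ m
    ... | inj₁ (refl , ry) = r'≢r , λ { refl → no-loop ry }
    ... | inj₂ (xy , x≢r , xy≢r'r) = x≢r , λ { refl → xy≢r'r (cong (_, r) (parent-unique xy r'r)) }

    -- An arc out of r is replaced by an arc out of r', which a path through r reaches just before r.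
    walk-from-root : ∀ {v} → Path A ρ v → v ≢ r → Walk contracted ρ v
    walk-from-root start _ = here
    walk-from-root (_▸_ {x} p xv) v≢r with x ≟ r
    ... | no x≢r = walk-snoc (walk-from-root p x≢r) (∈-contracted⁺-kept xv x≢r v≢r)
    walk-from-root (start ▸ xv) v≢r | yes refl = contradiction refl ρ≢r
    walk-from-root (p ▸ yr ▸ rv) v≢r | yes refl with parent-unique yr r'r
    ... | refl = walk-snoc (walk-from-root p r'≢r) (∈-contracted⁺-moved rv)

    contracted-indeg-root : indeg ρ contracted ≡ 0
    contracted-indeg-root = ≢⇒degree≡0 proj₂ contracted head≢ρ
      where
      head≢ρ : ∀ {a} → a ∈ contracted → proj₂ a ≢ ρ
      head≢ρ m with ∈-contracted⁻ m
      ... | inj₁ (_ , ry) = head≢root ry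
      ... | inj₂ (a∈A , _) = head≢root a∈A

    contracted-indeg-nonroot : ∀ v → v ≢ r → v ≢ ρ → indeg v contracted ≡ 1
    contracted-indeg-nonroot v v≢r v≢ρ = trans (indeg-redirect-++ v r' (filter moved? A) (filter kept? A))
      (trans (degree-partition proj₂ moved? kept? A exactly-one) (indeg-nonroot v tt v≢ρ))
      where
      exactly-one : ∀ {a} → a ∈ A → proj₂ a ≡ v → (Moved a × ¬ Kept a) ⊎ (¬ Moved a × Kept a)
      exactly-one {x , _} _ refl with x ≟ r
      ... | yes x≡r = inj₁ (x≡r , λ kept → proj₁ kept x≡r)
      ... | no x≢r = inj₂ (x≢r , x≢r , λ { refl → v≢r refl })

    contracted-isArb : IsArbRootedAt (minus r) ρ contracted
    contracted-isArb = contracted-on-vertices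
      , walks-from⇒connected (λ v v≢r → walk-from-root (path-from-root v tt) v≢r)
      , ρ≢r , contracted-indeg-root , contracted-indeg-nonroot

    contracted-leaves : NonRootsAreLeaves full ρ A → NonRootsAreLeaves (minus r) ρ contracted
    contracted-leaves leaves v v≢r v≢ρ = ≢⇒degree≡0 proj₁ contracted tail≢v
      where
      tail≢v : ∀ {a} → a ∈ contracted → proj₁ a ≢ v
      tail≢v m with ∈-contracted⁻ m
      ... | inj₁ (_ , ry) = λ _ → degree≡0⇒≢ proj₁ (leaves r tt (λ { refl → ρ≢r refl })) ry refl
      ... | inj₂ (a∈A , _) = degree≡0⇒≢ proj₁ (leaves v tt v≢ρ) a∈A

∈-contract⁻ : ∀ {n} {r r' : Fin n} {A a} → a ∈ contract r r' A →
              a ∈ A ⊎ (proj₁ a ≡ r' × (r , proj₂ a) ∈ A)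
∈-contract⁻ {r = r} {r'} {A} m with indeg r A ℕ.≟ 0
... | yes _ = [ (λ (tail≡r' , ry , _) → inj₂ (tail≡r' , ry)) , inj₁ ∘ proj₁ ]
                (ContractAtRoot.∈-contracted⁻ r r' A m)
... | no _ = [ inj₂ , inj₁ ∘ proj₁ ] (ContractAtNonRoot.∈-contracted⁻ r r' A m)

contract-isArb : ∀ {n} {r r' ρ : Fin n} {A} → IsArbRootedAt full ρ A → ValidChoice r A r' →
  ∃[ ρ' ] IsArbRootedAt (minus r) ρ' (contract r r' A)
        × (NonRootsAreLeaves full ρ A → NonRootsAreLeaves (minus r) ρ' (contract r r' A))
contract-isArb {r = r} {r'} {ρ} {A} isArb (at-root , at-nonroot) with indeg r A ℕ.≟ 0
... | yes d with refl ← Arborescence.indeg≡0⇒root isArb tt d | (r'≢r , rr') ← at-root d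
  = r' , contracted-isArb isArb r'≢r rr' , contracted-leaves isArb r'≢r rr'
  where open ContractAtRoot r r' A
... | no d≢0 with r'r ← at-nonroot d≢0
  = ρ , contracted-isArb isArb ρ≢r r'r , contracted-leaves isArb ρ≢r r'r
  where
  open ContractAtNonRoot r r' A
  ρ≢r : ρ ≢ r
  ρ≢r refl = d≢0 (Arborescence.indeg-root isArb)

module _ {n} {r : Fin n} {X : Set} (f g : X → Arc n)
         (rerouted : ∀ x → g x ≡ f x ⊎ g x ≡ (r , proj₂ (f x))) where

  same-head : ∀ x → proj₂ (g x) ≡ proj₂ (f x)
  same-head x with rerouted x
  ... | inj₁ gx≡fx = cong proj₂ gx≡fx
  ... | inj₂ gx≡ry = cong proj₂ gx≡ry

  attach-root : ∀ {ρ} xs → IsArbRootedAt (minus r) ρ (map f xs) →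
                IsArbRootedAt full r ((r , ρ) ∷ map g xs)
  attach-root {ρ} xs isArb =
    (λ _ → tt , tt) , walks-from⇒connected (λ v _ → walk-from-r v) , tt , indeg-r , indeg-other
    where
    open Arborescence isArb
    C : Arcs n
    C = (r , ρ) ∷ map g xs

    indeg-g≡indeg-f : ∀ v → indeg v (map g xs) ≡ indeg v (map f xs)
    indeg-g≡indeg-f v = degree-map-cong proj₂ g f same-head xs

    head≢r : ∀ {a} → a ∈ C → proj₂ a ≢ r
    head≢r (here refl) = root∈S
    head≢r (there m) with ∈-map⁻ g m
    ... | x , x∈xs , refl = subst (_≢ r) (sym (same-head x)) (proj₂ (on-vertices (∈-map⁺ f x∈xs)))

    indeg-r : indeg r C ≡ 0
    indeg-r = ≢⇒degree≡0 proj₂ C head≢r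

    indeg-other : ∀ v → full v → v ≢ r → indeg v C ≡ 1
    indeg-other v _ v≢r with ρ ≟ v
    ... | yes refl = cong suc (trans (indeg-g≡indeg-f ρ) indeg-root)
    ... | no ρ≢v = trans (indeg-g≡indeg-f v) (indeg-nonroot v v≢r (ρ≢v ∘ sym))

    -- A path of the old arborescence is followed until its last rerouted arc, which starts at r.
    path⇒walk : ∀ {u} → Path (map f xs) ρ u → Walk C r u
    path⇒walk start = fwd (here refl) here
    path⇒walk (p ▸ e) with ∈-map⁻ f e
    ... | x , x∈xs , refl with rerouted x | ∈-map⁺ g x∈xs
    ...   | inj₁ gx≡fx | gx∈ = walk-snoc (path⇒walk p) (there (subst (_∈ map g xs) gx≡fx gx∈))
    ...   | inj₂ gx≡ry | gx∈ = fwd (there (subst (_∈ map g xs) gx≡ry gx∈)) here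

    walk-from-r : ∀ v → Walk C r v
    walk-from-r v with v ≟ r
    ... | yes refl = here
    ... | no v≢r = path⇒walk (path-from-root v v≢r)

reroute : ∀ {n} → Fin n → Arcs n → Arc n → Arc n
reroute r Aᵢ (x , y) with any? ((r , y) ≟ᵃ_) Aᵢ
... | yes _ = (r , y)
... | no _ = (x , y)

reroute-cases : ∀ {n} (r : Fin n) Aᵢ x y →
  (reroute r Aᵢ (x , y) ≡ (r , y) × (r , y) ∈ Aᵢ) ⊎ (reroute r Aᵢ (x , y) ≡ (x , y) × (r , y) ∉ Aᵢ)
reroute-cases r Aᵢ x y with any? ((r , y) ≟ᵃ_) Aᵢ
... | yes ry = inj₁ (refl , ry)
... | no ry∉ = inj₂ (refl , ry∉)

module _ {k} (r : Fin (suc (suc k))) (A : Fin (suc k) → Arcs (suc (suc k))) (r' : Fin k → Fin (suc (suc k))) where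
  private
    n : ℕ
    n = suc (suc k)

  recolour : Fin k × Arc n → Fin (suc k) × Arc n
  recolour (i , a) = inject₁ i , reroute r (A (inject₁ i)) a

  rainbow-lift : IsStarRootedAt full r (A (fromℕ k)) →
                 RainbowArb (minus r) (λ i → contract r (r' i) (A (inject₁ i))) → RainbowArb full A
  rainbow-lift star (B' , B'⊆A' , unique' , ρ' , isArb') = B , B⊆A , unique , r , isArb
    where
    B : List (Fin (suc k) × Arc n)
    B = (fromℕ k , (r , ρ')) ∷ map recolour B'

    B⊆A : ∀ {j a} → (j , a) ∈ B → a ∈ A j
    B⊆A (here refl) = star-arc star (Arborescence.root∈S isArb')
    B⊆A (there m) with ∈-map⁻ recolour m
    ... | (i , (x , y)) , m' , refl with reroute-cases r (A (inject₁ i)) x y | ∈-contract⁻ (B'⊆A' m')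
    ...   | inj₁ (e , ry) | _ = subst (_∈ A (inject₁ i)) (sym e) ry
    ...   | inj₂ (e , _) | inj₁ xy = subst (_∈ A (inject₁ i)) (sym e) xy
    ...   | inj₂ (_ , ry∉) | inj₂ (_ , ry) = contradiction ry ry∉

    colours : map proj₁ (map recolour B') ≡ map inject₁ (map proj₁ B')
    colours = trans (sym (map-∘ B')) (map-∘ B')

    unique : Unique (map proj₁ B)
    unique = subst (All (fromℕ k ≢_)) (sym colours) (All.map⁺ (All.universal (λ _ → fromℕ≢inject₁) _))
           ∷ subst Unique (sym colours) (Unique.map⁺ inject₁-injective unique')

    rerouted : ∀ p → proj₂ (recolour p) ≡ proj₂ p ⊎ proj₂ (recolour p) ≡ (r , proj₂ (proj₂ p))
    rerouted (i , (x , y)) with reroute-cases r (A (inject₁ i)) x y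
    ... | inj₁ (e , _) = inj₂ e
    ... | inj₂ (e , _) = inj₁ e

    isArb : IsArbRootedAt full r (map proj₂ B)
    isArb = subst (λ C → IsArbRootedAt full r ((r , ρ') ∷ C)) (map-∘ B')
                  (attach-root proj₂ (proj₂ ∘ recolour) rerouted B' isArb')

lemma3p1 : (k : ℕ) (r : Fin (suc (suc k))) (A : Fin (suc k) → Arcs (suc (suc k)))
    → (∀ i → IsSpanningArb full (A i))
    → IsStarRootedAt full r (A (fromℕ k))
    → (r' : Fin k → Fin (suc (suc k)))
    → (∀ i → ValidChoice r (A (inject₁ i)) (r' i))
    → (∀ i → IsSpanningArb (minus r) (contract r (r' i) (A (inject₁ i))))
      × (∀ i → IsStar full (A (inject₁ i)) → IsStar (minus r) (contract r (r' i) (A (inject₁ i))))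
      × (RainbowArb (minus r) (λ i → contract r (r' i) (A (inject₁ i))) → RainbowArb full A)
lemma3p1 k r A arb star r' valid = spanning , stars , rainbow-lift r A r' star
  where
  spanning : ∀ i → IsSpanningArb (minus r) (contract r (r' i) (A (inject₁ i)))
  spanning i with ρ' , isArb' , _ ← contract-isArb (proj₂ (arb (inject₁ i))) (valid i)
    = ρ' , isArb'

  stars : ∀ i → IsStar full (A (inject₁ i)) → IsStar (minus r) (contract r (r' i) (A (inject₁ i)))
  stars i (_ , isArb , leaves) with ρ' , isArb' , leaves' ← contract-isArb isArb (valid i)
    = ρ' , isArb' , leaves' leaves
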